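{- The equation $((d^x+1)^s+1)^t-d^y=2$ has no solution in integers $d,x,y,s,t$ with $x\ge1$ and $d,s,t,y\ge2$. -}

-- If d is even, the left side is a t-th power of an even number and 4 ∣ d ^ y, so 4 ∣ 2.
-- If d is odd, put a = d ^ x and b = a + 1, which is even.  As (b ^ s + 1) ^ t ≡ 1 modulo b ^ s,
-- b ^ 2 divides d ^ y + 1.  Since a ≡ -1 modulo b, b ∣ d ^ y + 1 forces y = x * m with m odd,
-- and then d ^ y + 1 = a ^ m + 1 = b * (a ^ (m - 1) - ... - a + 1), whose cofactor is a sum
-- of m odd terms, hence odd; so b ^ 2 cannot divide it.

module Submission where

open import Data.Nat using (ℕ; _+_; _^_; _≤_)
open import Relation.Binary.PropositionalEquality using (_≡_)
open import Relation.Nullary using (¬_)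

open import Data.Nat using (zero; suc; _*_; _<_; _<?_; z<s; s<s; >-nonZero)
open import Data.Nat.Properties
open import Data.Nat.Divisibility
open import Data.Nat.Induction using (<-rec)
open import Data.Nat.Tactic.RingSolver using (solve-∀)
open import Data.Product using (∃-syntax; _×_; _,_; proj₁)
open import Data.Sum using (_⊎_; inj₁; inj₂)
open import Relation.Nullary using (yes; no; contradiction)
open import Relation.Binary.PropositionalEquality using (refl; sym; trans; cong; subst; module ≡-Reasoning)

Odd : ℕ → Set
Odd n = ∃[ k ] n ≡ 1 + 2 * k

even⊎odd : ∀ n → 2 ∣ n ⊎ Odd n
even⊎odd zero = inj₁ (2 ∣0)
even⊎odd (suc n) with even⊎odd n
... | inj₁ (divides q refl) = inj₂ (q , cong suc (*-comm q 2))
... | inj₂ (k , refl)       = inj₁ (divides (suc k) (2+2k≡[1+k]*2 k))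
  where
  2+2k≡[1+k]*2 : ∀ k → 2 + 2 * k ≡ suc k * 2
  2+2k≡[1+k]*2 = solve-∀

even⇒¬odd : ∀ {n} → 2 ∣ n → ¬ Odd n
even⇒¬odd (divides q refl) (k , eq) = even≢odd q k (trans (*-comm 2 q) eq)

even⇒odd+1 : ∀ {n} → 2 ∣ n → Odd (n + 1)
even⇒odd+1 (divides q refl) = q , q*2+1≡1+2q q
  where
  q*2+1≡1+2q : ∀ q → q * 2 + 1 ≡ 1 + 2 * q
  q*2+1≡1+2q = solve-∀

odd⇒even+1 : ∀ {n} → Odd n → 2 ∣ n + 1
odd⇒even+1 (k , refl) = divides (suc k) (1+2k+1≡[1+k]*2 k)
  where
  1+2k+1≡[1+k]*2 : ∀ k → 1 + 2 * k + 1 ≡ suc k * 2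
  1+2k+1≡[1+k]*2 = solve-∀

odd-* : ∀ {m n} → Odd m → Odd n → Odd (m * n)
odd-* (j , refl) (k , refl) = j + k + 2 * j * k , product j k
  where
  product : ∀ j k → (1 + 2 * j) * (1 + 2 * k) ≡ 1 + 2 * (j + k + 2 * j * k)
  product = solve-∀

odd-^ : ∀ {m} → Odd m → ∀ n → Odd (m ^ n)
odd-^ odd-m zero    = 0 , refl
odd-^ odd-m (suc n) = odd-* odd-m (odd-^ odd-m n)

^-monoˡ-∣ : ∀ {m n} k → m ∣ n → m ^ k ∣ n ^ k
^-monoˡ-∣ zero    m∣n = ∣-refl
^-monoˡ-∣ (suc k) m∣n = *-pres-∣ m∣n (^-monoˡ-∣ k m∣n)

^-monoʳ-∣ : ∀ m {k j} → k ≤ j → m ^ k ∣ m ^ j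
^-monoʳ-∣ m {k} k≤j with m≤n⇒∃[o]m+o≡n k≤j
... | o , refl = subst (m ^ k ∣_) (sym (^-distribˡ-+-* m k o)) (m∣m*n (m ^ o))

^-mono-∣ : ∀ {m n k j} → m ∣ n → k ≤ j → m ^ k ∣ n ^ j
^-mono-∣ {k = k} m∣n k≤j = ∣-trans (^-monoˡ-∣ k m∣n) (^-monoʳ-∣ _ k≤j)

[m+1]^n≡m*q+1 : ∀ m n → ∃[ q ] (m + 1) ^ n ≡ m * q + 1
[m+1]^n≡m*q+1 m zero    = 0 , cong (_+ 1) (sym (*-zeroʳ m))
[m+1]^n≡m*q+1 m (suc n) with [m+1]^n≡m*q+1 m n
... | q , eq = m * q + q + 1 , trans (cong ((m + 1) *_) eq) (expand m q)
  where
  expand : ∀ m q → (m + 1) * (m * q + 1) ≡ m * (m * q + q + 1) + 1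
  expand = solve-∀

[m+1]^n≡k+1⇒m∣k : ∀ m n {k} → (m + 1) ^ n ≡ k + 1 → m ∣ k
[m+1]^n≡k+1⇒m∣k m n {k} eq with [m+1]^n≡m*q+1 m n
... | q , eq′ = divides q (trans (+-cancelʳ-≡ 1 k (m * q) (trans (sym eq) eq′)) (*-comm m q))

a+1∣a*p+1⇒a+1∣p+a : ∀ a p → a + 1 ∣ a * p + 1 → a + 1 ∣ p + a
a+1∣a*p+1⇒a+1∣p+a a p h =
  ∣m+n∣m⇒∣n (subst (a + 1 ∣_) (sym (sum≡[p+1]*[a+1] a p)) (n∣m*n (p + 1))) h
  where
  sum≡[p+1]*[a+1] : ∀ a p → a * p + 1 + (p + a) ≡ (p + 1) * (a + 1)
  sum≡[p+1]*[a+1] = solve-∀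

a+1∣a*p+a⇒a+1∣p+1 : ∀ a p → a + 1 ∣ a * p + a → a + 1 ∣ p + 1
a+1∣a*p+a⇒a+1∣p+1 a p h =
  ∣m+n∣m⇒∣n (subst (a + 1 ∣_) (sym (sum≡[p+1]*[a+1] a p)) (n∣m*n (p + 1))) h
  where
  sum≡[p+1]*[a+1] : ∀ a p → a * p + a + (p + 1) ≡ (p + 1) * (a + 1)
  sum≡[p+1]*[a+1] = solve-∀

module _ {d x : ℕ} (1<d : 1 < d) (0<x : 0 < x) where

  private
    d^x+1∤d^r+1 : ∀ {r} → r < x → ¬ (d ^ x + 1 ∣ d ^ r + 1)
    d^x+1∤d^r+1 {r} r<x =
      >⇒∤ {{>-nonZero (m≤n+m 1 (d ^ r))}} (+-monoˡ-< 1 (^-monoʳ-< d 1<d r<x))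

    d^x+1∣d^r+d^x⇒r≡0 : ∀ {r} → r < x → d ^ x + 1 ∣ d ^ r + d ^ x → r ≡ 0
    d^x+1∣d^r+d^x⇒r≡0 {zero}  _   _ = refl
    d^x+1∣d^r+d^x⇒r≡0 {suc r} r<x h with m≤n⇒∃[o]m+o≡n (^-monoʳ-< d 1<d (z<s {n = r}))
    ... | p , 2+p≡d^r =
      contradiction (∣m+n∣m⇒∣n (subst (d ^ x + 1 ∣_) split h) ∣-refl) (>⇒∤ p+1<b)
      where
      regroup : ∀ p a → 2 + p + a ≡ a + 1 + suc p
      regroup = solve-∀
      split : d ^ suc r + d ^ x ≡ d ^ x + 1 + suc p
      split = trans (cong (_+ d ^ x) (sym 2+p≡d^r)) (regroup p (d ^ x))
      p+1<b : suc p < d ^ x + 1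
      p+1<b = <-trans (subst (suc p <_) 2+p≡d^r ≤-refl)
                      (<-trans (^-monoʳ-< d 1<d r<x) (m<m+n (d ^ x) z<s))

    -- Since d ^ x ≡ -1 modulo d ^ x + 1, the hypotheses say d ^ z ≡ -1 and d ^ z ≡ 1; passing
    -- from z to x + z swaps them, so they are tracked together.
    OddEvenMultiple : ℕ → Set
    OddEvenMultiple z = (d ^ x + 1 ∣ d ^ z + 1 → ∃[ k ] z ≡ x * (1 + 2 * k))
                      × (d ^ x + 1 ∣ d ^ z + d ^ x → ∃[ k ] z ≡ x * (2 * k))

    oddEvenMultiple-< : ∀ {z} → z < x → OddEvenMultiple z
    oddEvenMultiple-< z<x =
        (λ h → contradiction h (d^x+1∤d^r+1 z<x))
      , (λ h → 0 , trans (d^x+1∣d^r+d^x⇒r≡0 z<x h) (sym (*-zeroʳ x)))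

    oddEvenMultiple-x+ : ∀ {z} → OddEvenMultiple z → OddEvenMultiple (x + z)
    oddEvenMultiple-x+ {z} (odd , even) = odd′ , even′
      where
      d^[x+z] : d ^ (x + z) ≡ d ^ x * d ^ z
      d^[x+z] = ^-distribˡ-+-* d x z
      x+x*[1+2k]≡x*[2+2k] : ∀ x k → x + x * (1 + 2 * k) ≡ x * (2 * suc k)
      x+x*[1+2k]≡x*[2+2k] = solve-∀
      odd′ : d ^ x + 1 ∣ d ^ (x + z) + 1 → ∃[ k ] x + z ≡ x * (1 + 2 * k)
      odd′ h with even (a+1∣a*p+1⇒a+1∣p+a (d ^ x) (d ^ z)
                         (subst (λ n → d ^ x + 1 ∣ n + 1) d^[x+z] h))
      ... | k , refl = k , sym (*-suc x (2 * k))
      even′ : d ^ x + 1 ∣ d ^ (x + z) + d ^ x → ∃[ k ] x + z ≡ x * (2 * k)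
      even′ h with odd (a+1∣a*p+a⇒a+1∣p+1 (d ^ x) (d ^ z)
                         (subst (λ n → d ^ x + 1 ∣ n + d ^ x) d^[x+z] h))
      ... | k , refl = suc k , x+x*[1+2k]≡x*[2+2k] x k

    oddEvenMultiple-rec : ∀ z → (∀ {y} → y < z → OddEvenMultiple y) → OddEvenMultiple z
    oddEvenMultiple-rec z ih with z <? x
    ... | yes z<x = oddEvenMultiple-< z<x
    ... | no  z≮x with m≤n⇒∃[o]m+o≡n (≮⇒≥ z≮x)
    ...   | z′ , refl = oddEvenMultiple-x+ (ih (m<n+m z′ 0<x))

  d^x+1∣d^z+1⇒z≡x*[1+2k] : ∀ {z} → d ^ x + 1 ∣ d ^ z + 1 → ∃[ k ] z ≡ x * (1 + 2 * k)
  d^x+1∣d^z+1⇒z≡x*[1+2k] {z} =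
    proj₁ (<-rec OddEvenMultiple oddEvenMultiple-rec z)

odd⇒a^[1+2k]+1≡[a+1]*odd : ∀ {a} → Odd a → ∀ k →
                            ∃[ j ] a ^ (1 + 2 * k) + 1 ≡ (a + 1) * (1 + 2 * j)
odd⇒a^[1+2k]+1≡[a+1]*odd (e , refl) zero    = 0 , base e
  where
  base : ∀ e → (1 + 2 * e) * 1 + 1 ≡ (1 + 2 * e + 1) * 1
  base = solve-∀
odd⇒a^[1+2k]+1≡[a+1]*odd {a} (e , refl) (suc k) with odd⇒a^[1+2k]+1≡[a+1]*odd (e , refl) k
... | j , ih = J , subst (λ n → a ^ n + 1 ≡ (a + 1) * (1 + 2 * J)) (sym (cong suc (*-suc 2 k)))
                 (+-cancelʳ-≡ (a * a) _ _ step)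
  where
  -- The cofactor obeys S (k + 1) = a * a * S k - (a - 1), which for a = 1 + 2e and S k = 1 + 2j
  -- is 1 + 2J; `step` is this recurrence with the subtraction moved to the other side.
  J : ℕ
  J = e * (2 * e + 1) + a * a * j
  P : ℕ
  P = a ^ (1 + 2 * k)
  expand : ∀ a P → a * (a * P) + 1 + a * a ≡ a * a * (P + 1) + 1
  expand = solve-∀
  collect : ∀ e j → let a = 1 + 2 * e in
            a * a * ((a + 1) * (1 + 2 * j)) + 1 ≡ (a + 1) * (1 + 2 * (e * (2 * e + 1) + a * a * j)) + a * a
  collect = solve-∀
  step : a * (a * P) + 1 + a * a ≡ (a + 1) * (1 + 2 * J) + a * a
  step = begin
    a * (a * P) + 1 + a * a              ≡⟨ expand a P ⟩
    a * a * (P + 1) + 1                  ≡⟨ cong (λ n → a * a * n + 1) ih ⟩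
    a * a * ((a + 1) * (1 + 2 * j)) + 1  ≡⟨ collect e j ⟩
    (a + 1) * (1 + 2 * J) + a * a        ∎
    where open ≡-Reasoning

odd⇒[a+1]^2∤a^[1+2k]+1 : ∀ {a} → Odd a → ∀ k → ¬ ((a + 1) ^ 2 ∣ a ^ (1 + 2 * k) + 1)
odd⇒[a+1]^2∤a^[1+2k]+1 {a} odd-a@(e , refl) k h with odd⇒a^[1+2k]+1≡[a+1]*odd odd-a k
... | j , eq = even⇒¬odd (∣-trans (odd⇒even+1 odd-a) a+1∣odd) (j , refl)
  where
  a+1∣odd : a + 1 ∣ 1 + 2 * j
  a+1∣odd = m*n∣⇒m∣ (a + 1) 1 (*-cancelˡ-∣ (a + 1) (subst ((a + 1) ^ 2 ∣_) eq h))

4∤2 : ¬ (4 ∣ 2)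
4∤2 = >⇒∤ (s<s (s<s z<s))

even-case : ∀ d x y s t → 2 ∣ d → 1 ≤ x → 2 ≤ t → 2 ≤ y →
            ¬ (((d ^ x + 1) ^ s + 1) ^ t ≡ d ^ y + 2)
even-case d x y s t 2∣d 1≤x 2≤t 2≤y eq =
  4∤2 (∣m+n∣m⇒∣n (subst (4 ∣_) eq (^-mono-∣ 2∣lhs 2≤t)) (^-mono-∣ 2∣d 2≤y))
  where
  2∣lhs : 2 ∣ (d ^ x + 1) ^ s + 1
  2∣lhs = odd⇒even+1 (odd-^ (even⇒odd+1 (^-mono-∣ 2∣d 1≤x)) s)

[b^s+1]^t≡n+2⇒b^2∣n+1 : ∀ b s t {n} → 2 ≤ s → (b ^ s + 1) ^ t ≡ n + 2 → b ^ 2 ∣ n + 1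
[b^s+1]^t≡n+2⇒b^2∣n+1 b s t {n} 2≤s eq =
  ∣-trans (^-mono-∣ ∣-refl 2≤s) ([m+1]^n≡k+1⇒m∣k (b ^ s) t (trans eq (sym (+-assoc n 1 1))))

odd-case : ∀ d x y s t → Odd d → 2 ≤ d → 1 ≤ x → 2 ≤ s →
           ¬ (((d ^ x + 1) ^ s + 1) ^ t ≡ d ^ y + 2)
odd-case d x y s t odd-d 2≤d 1≤x 2≤s eq with [b^s+1]^t≡n+2⇒b^2∣n+1 (d ^ x + 1) s t 2≤s eq
... | b²∣d^y+1 with d^x+1∣d^z+1⇒z≡x*[1+2k] 2≤d 1≤x {y} (m*n∣⇒m∣ (d ^ x + 1) _ b²∣d^y+1)
... | k , refl = odd⇒[a+1]^2∤a^[1+2k]+1 (odd-^ odd-d x) k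
                   (subst (λ n → (d ^ x + 1) ^ 2 ∣ n + 1) (sym (^-*-assoc d x (1 + 2 * k))) b²∣d^y+1)

proposition4 : (d x y s t : ℕ) → 1 ≤ x → 2 ≤ d → 2 ≤ s → 2 ≤ t → 2 ≤ y →
    ¬ (((d ^ x + 1) ^ s + 1) ^ t ≡ d ^ y + 2)
proposition4 d x y s t 1≤x 2≤d 2≤s 2≤t 2≤y with even⊎odd d
... | inj₁ 2∣d  = even-case d x y s t 2∣d 1≤x 2≤t 2≤y
... | inj₂ odd-d = odd-case d x y s t odd-d 2≤d 1≤x 2≤s
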